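{- Let $k \ge 3$ and let $G=(V,E)$ be the infinite $k$-regular tree with origin $\mathbf{0}$. Fix arbitrary rotor sequences and arbitrary initial rotor positions $\mathrm{arr}(\mathbf{x},0)$ for all $\mathbf{x}\in V$. Let $\pi\colon V\times\mathbb{N}_0\to\{0,1,\ldots,k-1\}$ be any function with $\pi(\mathbf{x},t)=0$ whenever $|\mathbf{x}|\not\equiv t \pmod 2$. Then there is an even initial chip configuration $(f(\mathbf{x},0))_{\mathbf{x}\in V}$ such that the rotor-router machine started from this chip configuration and these rotor positions satisfies $f(\mathbf{x},t)\equiv \pi(\mathbf{x},t) \pmod k$ for all $\mathbf{x}\in V$ and all $t\ge 0$.
   Context: $|\mathbf{x}|$ denotes the graph distance from $\mathbf{x}$ to the fixed vertex $\mathbf{0}$. Each vertex $\mathbf{x}$ carries a rotor sequence, i.e. a cyclic ordering of its $k$ neighbours (different vertices may have different rotor sequences), and a rotor pointing to one of its neighbours. The rotor-router (Propp) machine: an initial configuration assigns to each vertex $\mathbf{x}$ a nonnegative integer number $f(\mathbf{x},0)$ of chips and a rotor position $\mathrm{arr}(\mathbf{x},0)$. In each round (from time $t$ to $t+1$), every vertex $\mathbf{x}$ sends all of its $f(\mathbf{x},t)$ chips away one after the other; each chip is moved to the neighbour the rotor of $\mathbf{x}$ currently points to, after which the rotor is advanced to the next neighbour in the rotor sequence of $\mathbf{x}$. $f(\mathbf{x},t)$ denotes the number of chips on $\mathbf{x}$ after $t$ rounds. An initial chip configuration is even if $f(\mathbf{x},0)=0$ whenever $|\mathbf{x}|$ is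 odd. -}

module Defs where

open import Data.Nat using (ℕ; zero; suc; _+_; _%_; NonZero)
open import Data.Nat.DivMod using (_mod_)
open import Data.Fin using (Fin; toℕ; _≟_)
open import Data.Fin.Permutation using (Permutation′; _⟨$⟩ʳ_; _⟨$⟩ˡ_)
open import Data.Bool using (Bool; true; false; not; _∧_; T; if_then_else_)
open import Data.Unit using (tt)
open import Data.List using (List; []; _∷_; length; map; allFin)
open import Data.Nat.ListAction using (sum)
open import Data.Product using (Σ; _,_; proj₁)
open import Relation.Nullary using (does; yes; no; ¬_)
open import Relation.Binary.PropositionalEquality using (_≡_)

-- A word over the alphabet Fin k is reduced if no two adjacent letters coincide.
-- Words are stored with the most recently appended letter at the head.
isReduced : ∀ {k} → List (Fin k) → Bool
isReduced [] = true
isReduced (a ∷ []) = true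
isReduced (a ∷ b ∷ w) = not (does (a ≟ b)) ∧ isReduced (b ∷ w)

private
  T-∧-r : ∀ x y → T (x ∧ y) → T y
  T-∧-r true y p = p

  red-tail : ∀ {k} (b : Fin k) w → T (isReduced (b ∷ w)) → T (isReduced w)
  red-tail b [] _ = tt
  red-tail b (c ∷ w) p = T-∧-r _ _ p

  red-cons : ∀ {k} (a b : Fin k) w → ¬ a ≡ b → T (isReduced (b ∷ w)) → T (isReduced (a ∷ b ∷ w))
  red-cons a b w a≢b p with a ≟ b
  ... | yes e = a≢b e
  ... | no _ = p

-- Vertices of the infinite k-regular tree: reduced words over Fin k
-- (Cayley graph of the free product of k copies of Z/2); origin 0 = empty word.
V : ℕ → Set
V k = Σ (List (Fin k)) (λ w → T (isReduced w))

origin : ∀ {k} → V k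
origin = [] , tt

-- graph distance |x| to the origin = length of the reduced word
∣_∣ᵥ : ∀ {k} → V k → ℕ
∣ x ∣ᵥ = length (proj₁ x)

-- the neighbour of x along the edge labelled a (the k neighbours of x are x · a, a : Fin k);
-- note (x · a) · a = x.
_·_ : ∀ {k} → V k → Fin k → V k
([] , _) · a = (a ∷ [] , tt)
((b ∷ w) , p) · a with a ≟ b
... | yes _ = (w , red-tail b w p)
... | no a≢b = (a ∷ b ∷ w , red-cons a b w a≢b p)

module _ (k : ℕ) {{_ : NonZero k}} where

  -- a rotor sequence at x: a cyclic ordering of the k neighbours of x, given as a
  -- bijection from positions Fin k (cyclically ordered) to edge labels Fin k.
  RotorSeqs : Set
  RotorSeqs = V k → Permutation′ k

  next : Fin k → Fin k
  next p = suc (toℕ p) mod k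

  sent : Fin k → ℕ → Fin k → ℕ
  sent p zero q = 0
  sent p (suc n) q = (if does (p ≟ q) then 1 else 0) + sent (next p) n q

  advance : Fin k → ℕ → Fin k
  advance p zero = p
  advance p (suc n) = advance (next p) n

  -- a configuration: chips at each vertex and rotor position (index into the rotor sequence)
  record Config : Set where
    constructor config
    field
      chips : V k → ℕ
      rotor : V k → Fin k
  open Config public

  step : RotorSeqs → Config → Config
  step σ c = config newChips newRotor
    where
      sentAlong : V k → Fin k → ℕ
      sentAlong x a = sent (rotor c x) (chips c x) (σ x ⟨$⟩ˡ a)
      newChips : V k → ℕ
      newChips y = sum (map (λ a → sentAlong (y · a) a) (allFin k))
      newRotor : V k → Fin k
      newRotor x = advance (rotor c x) (chips c x)

  -- the machine after t rounds, started from chips f0 and initial rotors arr0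
  -- (arr0 x is the edge label of the neighbour the rotor of x points to)
  run : RotorSeqs → (V k → Fin k) → (V k → ℕ) → ℕ → Config
  run σ arr0 f0 zero = config f0 (λ x → σ x ⟨$⟩ˡ arr0 x)
  run σ arr0 f0 (suc t) = step σ (run σ arr0 f0 t)

  chipsAt : RotorSeqs → (V k → Fin k) → (V k → ℕ) → V k → ℕ → ℕ
  chipsAt σ arr0 f0 x t = chips (run σ arr0 f0 t) x

IsEven : ∀ {k} → (V k → ℕ) → Set
IsEven f0 = ∀ x → ∣ x ∣ᵥ % 2 ≡ 1 → f0 x ≡ 0

-- Adding k^n·h chips to a configuration changes no rotor during the first n rounds, and after
-- s ≤ n rounds it has added exactly k^(n∸s)·(A^s h) chips, A the adjacency operator of the
-- tree: k·c extra chips on a vertex send c chips to every neighbour and bring its rotor back.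
-- So adding multiples of k^(t+1) does not change any f(x,t) mod k, and the residues can be
-- prescribed for t = 0, 1, 2, … in turn. To add c to f(x,t) mod k, put k^t·c chips on the
-- vertex t levels beneath x reached by always stepping away from the origin: x reaches it by
-- a single walk of length t, and every other vertex reaching it in t steps is deeper than x,
-- so the corrections of time t can be chosen by increasing depth. A vertex at depth n only
-- receives corrections of times t ≤ n, so the stages converge pointwise; corrections are
-- made only when |x| ≡ t (mod 2) and land at depth t + |x|, which keeps the configuration
-- even. Two outward edge labels suffice, so only k ≥ 2 is used.

module Submission where

open import Defs
open import Data.Nat using (ℕ; zero; suc; _+_; _*_; _∸_; _%_; _/_; _^_; _≤_; _<_; _≤?_; _<?_; pred; NonZero; >-nonZero; >-nonZero⁻¹; z≤n; s≤s)
  renaming (_≟_ to _≟ℕ_)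
open import Data.Nat.Properties hiding (_≟_)
open import Data.Nat.DivMod
open import Data.Nat.Divisibility using (divides; >⇒∤)
open import Data.Nat.ListAction using (sum)
open import Data.Fin using (Fin; toℕ; _≟_)
open import Data.Fin.Permutation using (_⟨$⟩ˡ_)
open import Data.Fin.Properties using (toℕ-injective; toℕ<n; toℕ-fromℕ<)
open import Data.Bool using (T; if_then_else_)
open import Data.Bool.Properties using (T-∧; T-irrelevant)
open import Data.Unit using (tt)
open import Data.List using (List; []; _∷_; _++_; [_]; length; drop; map; tabulate; allFin)
open import Data.List.Properties using (length-++; ++-assoc; ∷-injectiveˡ; map-cong; map-tabulate)
  renaming (≡-dec to List-≡-dec)
open import Data.Product using (Σ; _,_; proj₁; proj₂; _×_)
open import Data.Sum using (_⊎_; inj₁; inj₂)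
open import Function using (_∘_; case_of_; Equivalence)
open import Algebra.Properties.CommutativeSemigroup +-commutativeSemigroup using (interchange)
open import Relation.Nullary using (Dec; does; yes; no; ¬_; contradiction)
open import Relation.Nullary.Decidable using (dec-true; dec-false)
open import Relation.Binary.Definitions using (DecidableEquality)
open import Relation.Binary.PropositionalEquality hiding ([_])
open import Data.Nat.Solver using (module +-*-Solver)
open +-*-Solver using (solve; _:+_; _:*_; _:=_)

%2-cases : ∀ n → n % 2 ≡ 0 ⊎ n % 2 ≡ 1
%2-cases n with n % 2 | m%n<n n 2
... | 0 | _ = inj₁ refl
... | 1 | _ = inj₂ refl
... | suc (suc _) | s≤s (s≤s ())

m%2≡n%2⇒[m+n]%2≡0 : ∀ m n → m % 2 ≡ n % 2 → (m + n) % 2 ≡ 0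
m%2≡n%2⇒[m+n]%2≡0 m n m≡n with %2-cases m | %2-cases n
... | inj₁ m0 | inj₁ n0 = trans (%-distribˡ-+ m n 2) (cong₂ (λ a b → (a + b) % 2) m0 n0)
... | inj₂ m1 | inj₂ n1 = trans (%-distribˡ-+ m n 2) (cong₂ (λ a b → (a + b) % 2) m1 n1)
... | inj₁ m0 | inj₂ n1 = contradiction (trans (sym m0) (trans m≡n n1)) 0≢1+n
... | inj₂ m1 | inj₁ n0 = contradiction (trans (sym n0) (trans (sym m≡n) m1)) 0≢1+n

m%2≢n%2⇒[m+n]%2≡1 : ∀ m n → m % 2 ≢ n % 2 → (m + n) % 2 ≡ 1
m%2≢n%2⇒[m+n]%2≡1 m n m≢n with %2-cases m | %2-cases n
... | inj₁ m0 | inj₂ n1 = trans (%-distribˡ-+ m n 2) (cong₂ (λ a b → (a + b) % 2) m0 n1)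
... | inj₂ m1 | inj₁ n0 = trans (%-distribˡ-+ m n 2) (cong₂ (λ a b → (a + b) % 2) m1 n0)
... | inj₁ m0 | inj₁ n0 = contradiction (trans m0 (sym n0)) m≢n
... | inj₂ m1 | inj₂ n1 = contradiction (trans m1 (sym n1)) m≢n

%-complement : ∀ k {{_ : NonZero k}} c r w → r < k → (c + (r + (k ∸ c % k) + k * w)) % k ≡ r
%-complement k c r w r<k = begin
  (c + (r + (k ∸ c % k) + k * w)) % k
    ≡⟨ cong (λ n → (n + (r + (k ∸ c % k) + k * w)) % k) (m≡m%n+[m/n]*n c k) ⟩
  (c % k + c / k * k + (r + (k ∸ c % k) + k * w)) % k
    ≡⟨ cong (_% k) (regroup (c % k) (c / k) r (k ∸ c % k) w k) ⟩
  (r + (c % k + (k ∸ c % k) + (c / k + w) * k)) % k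
    ≡⟨ cong (λ n → (r + (n + (c / k + w) * k)) % k) (m+[n∸m]≡n (m%n≤n c k)) ⟩
  (r + suc (c / k + w) * k) % k
    ≡⟨ [m+kn]%n≡m%n r (suc (c / k + w)) k ⟩
  r % k
    ≡⟨ m<n⇒m%n≡m r<k ⟩
  r ∎
  where
  open ≡-Reasoning
  regroup : ∀ a q r b w k → a + q * k + (r + b + k * w) ≡ r + (a + b + (q + w) * k)
  regroup = solve 6 (λ a q r b w k → a :+ q :* k :+ (r :+ b :+ k :* w) := r :+ (a :+ b :+ (q :+ w) :* k)) refl

if-yes : ∀ {P : Set} (p? : Dec P) {a : ℕ} → P → (if does p? then a else 0) ≡ a
if-yes p? p = cong (if_then _ else 0) (dec-true p? p)

if-no : ∀ {P : Set} (p? : Dec P) {a : ℕ} → ¬ P → (if does p? then a else 0) ≡ 0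
if-no p? ¬p = cong (if_then _ else 0) (dec-false p? ¬p)

module _ {A : Set} where

  sum-map-zero : ∀ (l : List A) {f : A → ℕ} → (∀ a → f a ≡ 0) → sum (map f l) ≡ 0
  sum-map-zero [] f≡0 = refl
  sum-map-zero (a ∷ l) f≡0 = cong₂ _+_ (f≡0 a) (sum-map-zero l f≡0)

  sum-map-+ : ∀ (l : List A) (f g : A → ℕ) → sum (map (λ a → f a + g a) l) ≡ sum (map f l) + sum (map g l)
  sum-map-+ [] f g = refl
  sum-map-+ (a ∷ l) f g = trans (cong (f a + g a +_) (sum-map-+ l f g)) (interchange (f a) (g a) _ _)

  sum-map-* : ∀ (l : List A) c (f : A → ℕ) → sum (map (λ a → c * f a) l) ≡ c * sum (map f l)
  sum-map-* [] c f = sym (*-zeroʳ c)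
  sum-map-* (a ∷ l) c f = trans (cong (c * f a +_) (sum-map-* l c f)) (sym (*-distribˡ-+ c (f a) _))

sum-tabulate-single : ∀ {n} (f : Fin n → ℕ) a → (∀ b → b ≢ a → f b ≡ 0) → sum (tabulate f) ≡ f a
sum-tabulate-single f Fin.zero off = trans (cong (f Fin.zero +_) rest≡0) (+-identityʳ _)
  where
  rest≡0 : sum (tabulate (f ∘ Fin.suc)) ≡ 0
  rest≡0 = trans (cong sum (sym (map-tabulate (λ b → b) (f ∘ Fin.suc)))) (sum-map-zero (allFin _) λ b → off (Fin.suc b) λ ())
sum-tabulate-single f (Fin.suc a) off =
  cong₂ _+_ (off Fin.zero λ ()) (sum-tabulate-single (f ∘ Fin.suc) a λ b b≢a → off (Fin.suc b) λ { refl → b≢a refl })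

sum-allFin-single : ∀ n (f : Fin n → ℕ) a → (∀ b → b ≢ a → f b ≡ 0) → sum (map f (allFin n)) ≡ f a
sum-allFin-single n f a off = trans (cong sum (map-tabulate (λ b → b) f)) (sum-tabulate-single f a off)

module RotorArithmetic (k : ℕ) {{_ : NonZero k}} where
  open ≡-Reasoning

  toℕ-advance : ∀ p n → toℕ (advance k p n) ≡ (toℕ p + n) % k
  toℕ-advance p zero = begin
    toℕ p            ≡⟨ m<n⇒m%n≡m (toℕ<n p) ⟨
    toℕ p % k        ≡⟨ cong (_% k) (+-identityʳ (toℕ p)) ⟨
    (toℕ p + 0) % k  ∎
  toℕ-advance p (suc n) = begin
    toℕ (advance k (next k p) n)   ≡⟨ toℕ-advance (next k p) n ⟩
    (toℕ (next k p) + n) % k       ≡⟨ cong (λ r → (r + n) % k) (toℕ-fromℕ< (m%n<n (suc (toℕ p)) k)) ⟩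
    (suc (toℕ p) % k + n) % k      ≡⟨ %-distribˡ-+ (suc (toℕ p) % k) n k ⟩
    (suc (toℕ p) % k % k + n % k) % k ≡⟨ cong (λ r → (r + n % k) % k) (m%n%n≡m%n (suc (toℕ p)) k) ⟩
    (suc (toℕ p) % k + n % k) % k  ≡⟨ %-distribˡ-+ (suc (toℕ p)) n k ⟨
    (suc (toℕ p) + n) % k          ≡⟨ cong (_% k) (+-suc (toℕ p) n) ⟨
    (toℕ p + suc n) % k            ∎

  advance-+ : ∀ p m n → advance k p (m + n) ≡ advance k (advance k p m) n
  advance-+ p zero n = refl
  advance-+ p (suc m) n = advance-+ (next k p) m n

  advance-period : ∀ p → advance k p k ≡ p
  advance-period p = toℕ-injective (begin
    toℕ (advance k p k) ≡⟨ toℕ-advance p k ⟩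
    (toℕ p + k) % k     ≡⟨ [m+n]%n≡m%n (toℕ p) k ⟩
    toℕ p % k           ≡⟨ m<n⇒m%n≡m (toℕ<n p) ⟩
    toℕ p               ∎)

  advance-multiple : ∀ p d → advance k p (k * d) ≡ p
  advance-multiple p zero = cong (advance k p) (*-zeroʳ k)
  advance-multiple p (suc d) = begin
    advance k p (k * suc d)           ≡⟨ cong (advance k p) (*-suc k d) ⟩
    advance k p (k + k * d)           ≡⟨ advance-+ p k (k * d) ⟩
    advance k (advance k p k) (k * d) ≡⟨ cong (λ r → advance k r (k * d)) (advance-period p) ⟩
    advance k p (k * d)               ≡⟨ advance-multiple p d ⟩
    p                                 ∎

  advance-≢ : ∀ q i → 0 < i → i < k → advance k q i ≢ q
  advance-≢ q i 0<i i<k eq = >⇒∤ {{>-nonZero 0<i}} i<k (divides ((toℕ q + i) / k) (+-cancelˡ-≡ (toℕ q) i _ (begin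
    toℕ q + i                                 ≡⟨ m≡m%n+[m/n]*n (toℕ q + i) k ⟩
    (toℕ q + i) % k + (toℕ q + i) / k * k     ≡⟨ cong (_+ (toℕ q + i) / k * k) (trans (sym (toℕ-advance q i)) (cong toℕ eq)) ⟩
    toℕ q + (toℕ q + i) / k * k               ∎)))

  sent-+ : ∀ p m n q → sent k p (m + n) q ≡ sent k p m q + sent k (advance k p m) n q
  sent-+ p zero n q = refl
  sent-+ p (suc m) n q = trans (cong (hit +_) (sent-+ (next k p) m n q)) (sym (+-assoc hit _ _))
    where
    hit : ℕ
    hit = if does (p ≟ q) then 1 else 0

  sent-miss : ∀ p n q → (∀ i → i < n → advance k p i ≢ q) → sent k p n q ≡ 0
  sent-miss p zero q miss = refl
  sent-miss p (suc n) q miss with p ≟ q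
  ... | yes p≡q = contradiction p≡q (miss 0 (s≤s z≤n))
  ... | no _ = sent-miss (next k p) n q (λ i i<n → miss (suc i) (s≤s i<n))

  -- split off the first chip of sent k p (suc k) q, and alternatively the last one
  sent-period-next : ∀ p q → sent k (next k p) k q ≡ sent k p k q
  sent-period-next p q = +-cancelˡ-≡ hit _ _ (begin
    hit + sent k (next k p) k q                ≡⟨⟩
    sent k p (suc k) q                         ≡⟨ cong (λ n → sent k p n q) (+-comm 1 k) ⟩
    sent k p (k + 1) q                         ≡⟨ sent-+ p k 1 q ⟩
    sent k p k q + sent k (advance k p k) 1 q  ≡⟨ cong (λ r → sent k p k q + sent k r 1 q) (advance-period p) ⟩
    sent k p k q + (hit + 0)                   ≡⟨ cong (sent k p k q +_) (+-identityʳ hit) ⟩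
    sent k p k q + hit                         ≡⟨ +-comm (sent k p k q) hit ⟩
    hit + sent k p k q                         ∎)
    where
    hit : ℕ
    hit = if does (p ≟ q) then 1 else 0

  sent-period-advance : ∀ p n q → sent k (advance k p n) k q ≡ sent k p k q
  sent-period-advance p zero q = refl
  sent-period-advance p (suc n) q = trans (sent-period-advance (next k p) n q) (sent-period-next p q)

  sent-period-self : ∀ q → sent k q k q ≡ 1
  sent-period-self q = trans (cong (λ n → sent k q n q) (sym (suc-pred k))) (first-hit (q ≟ q))
    where
    later-miss : sent k (next k q) (pred k) q ≡ 0
    later-miss = sent-miss (next k q) (pred k) q λ i i<k-1 →
      advance-≢ q (suc i) (s≤s z≤n) (subst (suc i <_) (suc-pred k) (s≤s i<k-1))
    first-hit : (q≟q : Dec (q ≡ q)) → (if does q≟q then 1 else 0) + sent k (next k q) (pred k) q ≡ 1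
    first-hit (yes _) = cong suc later-miss
    first-hit (no q≢q) = contradiction refl q≢q

  sent-period : ∀ p q → sent k p k q ≡ 1
  sent-period p q = begin
    sent k p k q               ≡⟨ cong (λ r → sent k r k q) q↝p ⟨
    sent k (advance k q n) k q ≡⟨ sent-period-advance q n q ⟩
    sent k q k q               ≡⟨ sent-period-self q ⟩
    1                          ∎
    where
    n : ℕ
    n = k ∸ toℕ q + toℕ p
    q↝p : advance k q n ≡ p
    q↝p = toℕ-injective (begin
      toℕ (advance k q n)                ≡⟨ toℕ-advance q n ⟩
      (toℕ q + (k ∸ toℕ q + toℕ p)) % k  ≡⟨ cong (_% k) (+-assoc (toℕ q) (k ∸ toℕ q) (toℕ p)) ⟨
      (toℕ q + (k ∸ toℕ q) + toℕ p) % k  ≡⟨ cong (λ r → (r + toℕ p) % k) (m+[n∸m]≡n (<⇒≤ (toℕ<n q))) ⟩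
      (k + toℕ p) % k                    ≡⟨ cong (_% k) (+-comm k (toℕ p)) ⟩
      (toℕ p + k) % k                    ≡⟨ [m+n]%n≡m%n (toℕ p) k ⟩
      toℕ p % k                          ≡⟨ m<n⇒m%n≡m (toℕ<n p) ⟩
      toℕ p                              ∎)

  sent-multiple : ∀ p d q → sent k p (k * d) q ≡ d
  sent-multiple p zero q = cong (λ n → sent k p n q) (*-zeroʳ k)
  sent-multiple p (suc d) q = begin
    sent k p (k * suc d) q                          ≡⟨ cong (λ n → sent k p n q) (*-suc k d) ⟩
    sent k p (k + k * d) q                          ≡⟨ sent-+ p k (k * d) q ⟩
    sent k p k q + sent k (advance k p k) (k * d) q ≡⟨ cong₂ _+_ (sent-period p q) (cong (λ r → sent k r (k * d) q) (advance-period p)) ⟩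
    1 + sent k p (k * d) q                          ≡⟨ cong suc (sent-multiple p d q) ⟩
    suc d                                           ∎

  advance-+-multiple : ∀ p c d → advance k p (c + k * d) ≡ advance k p c
  advance-+-multiple p c d = trans (advance-+ p c (k * d)) (advance-multiple (advance k p c) d)

  sent-+-multiple : ∀ p c d q → sent k p (c + k * d) q ≡ sent k p c q + d
  sent-+-multiple p c d q = trans (sent-+ p c (k * d) q) (cong (sent k p c q +_) (sent-multiple (advance k p c) d q))


module _ {k : ℕ} where

  V-≡ : {x y : V k} → proj₁ x ≡ proj₁ y → x ≡ y
  V-≡ {w , r} {.w , r′} refl = cong (w ,_) (T-irrelevant r r′)

  _≟ᵥ_ : DecidableEquality (V k)
  x ≟ᵥ y with List-≡-dec _≟_ (proj₁ x) (proj₁ y)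
  ... | yes x≡y = yes (V-≡ x≡y)
  ... | no x≢y = no (x≢y ∘ cong proj₁)

  isReduced-tail : ∀ (a : Fin k) w → T (isReduced (a ∷ w)) → T (isReduced w)
  isReduced-tail a [] _ = tt
  isReduced-tail a (b ∷ w) r = proj₂ (Equivalence.to T-∧ r)

  isReduced-drop : ∀ n (w : List (Fin k)) → T (isReduced w) → T (isReduced (drop n w))
  isReduced-drop zero w r = r
  isReduced-drop (suc n) [] r = tt
  isReduced-drop (suc n) (a ∷ w) r = isReduced-drop n w (isReduced-tail a w r)

  dropᵥ : ℕ → V k → V k
  dropᵥ n (w , r) = drop n w , isReduced-drop n w r

  ·-cases : ∀ (x : V k) a → proj₁ (x · a) ≡ a ∷ proj₁ x ⊎ suc ∣ x · a ∣ᵥ ≡ ∣ x ∣ᵥ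
  ·-cases ([] , _) a = inj₁ refl
  ·-cases ((b ∷ w) , _) a with a ≟ b
  ... | yes _ = inj₂ refl
  ... | no _ = inj₁ refl

  ∣·∣≤ : ∀ (x : V k) a → ∣ x · a ∣ᵥ ≤ suc ∣ x ∣ᵥ
  ∣·∣≤ x a with ·-cases x a
  ... | inj₁ x·a≡ = ≤-reflexive (cong length x·a≡)
  ... | inj₂ x·a< = m≤n⇒m≤1+n (≤-trans (n≤1+n _) (≤-reflexive x·a<))

  ·-extends : ∀ (x : V k) a → (∀ b w → proj₁ x ≡ b ∷ w → a ≢ b) → proj₁ (x · a) ≡ a ∷ proj₁ x
  ·-extends ([] , _) a _ = refl
  ·-extends ((b ∷ w) , _) a a≢first with a ≟ b
  ... | yes a≡b = contradiction a≡b (a≢first b w refl)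
  ... | no _ = refl

  ·-injective-extending : ∀ (x : V k) a b → proj₁ (x · b) ≡ b ∷ proj₁ x → x · a ≡ x · b → a ≡ b
  ·-injective-extending x a b x·b≡ x·a≡x·b with ·-cases x a
  ... | inj₁ x·a≡ = ∷-injectiveˡ (trans (sym x·a≡) (trans (cong proj₁ x·a≡x·b) x·b≡))
  ... | inj₂ x·a< = contradiction (trans (sym x·a<) (cong suc (trans (cong ∣_∣ᵥ x·a≡x·b) (cong length x·b≡)))) (m≢1+n+m ∣ x ∣ᵥ {1})

  ·-parity : ∀ (x : V k) a t → (∣ x · a ∣ᵥ + t) % 2 ≡ (∣ x ∣ᵥ + suc t) % 2
  ·-parity x a t with ·-cases x a
  ... | inj₁ x·a≡ = trans (cong (λ w → (length w + t) % 2) x·a≡) (cong (_% 2) (sym (+-suc ∣ x ∣ᵥ t)))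
  ... | inj₂ x·a< = begin
    (∣ x · a ∣ᵥ + t) % 2        ≡⟨ [m+n]%n≡m%n (∣ x · a ∣ᵥ + t) 2 ⟨
    (∣ x · a ∣ᵥ + t + 2) % 2    ≡⟨ cong (_% 2) (+-comm (∣ x · a ∣ᵥ + t) 2) ⟩
    (2 + (∣ x · a ∣ᵥ + t)) % 2  ≡⟨ cong (λ n → suc n % 2) (+-suc ∣ x · a ∣ᵥ t) ⟨
    (suc ∣ x · a ∣ᵥ + suc t) % 2 ≡⟨ cong (λ n → (n + suc t) % 2) x·a< ⟩
    (∣ x ∣ᵥ + suc t) % 2        ∎
    where open ≡-Reasoning

  record Beneath (t : ℕ) (x z : V k) : Set where
    constructor beneath
    field
      path : List (Fin k)
      length-path : length path ≡ t
      word≡path++word : proj₁ z ≡ path ++ proj₁ x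

  beneath-depth : ∀ {t x z} → Beneath t x z → ∣ z ∣ᵥ ≡ t + ∣ x ∣ᵥ
  beneath-depth {x = x} (beneath u refl z≡) = trans (cong length z≡) (length-++ u)

  beneath-drop : ∀ {t x z} → Beneath t x z → dropᵥ t z ≡ x
  beneath-drop {x = x} (beneath u refl z≡) = V-≡ (trans (cong (drop (length u)) z≡) (drop-++ u))
    where
    drop-++ : ∀ u → drop (length u) (u ++ proj₁ x) ≡ proj₁ x
    drop-++ [] = refl
    drop-++ (_ ∷ u) = drop-++ u

  beneath-· : ∀ {t x z} a → proj₁ (x · a) ≡ a ∷ proj₁ x → Beneath t (x · a) z → Beneath (suc t) x z
  beneath-· {x = x} a x·a≡ (beneath u refl z≡) =
    beneath (u ++ [ a ]) (trans (length-++ u) (+-comm (length u) 1))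
     (trans z≡ (trans (cong (u ++_) x·a≡) (sym (++-assoc u [ a ] (proj₁ x)))))

  Walk : ℕ → V k → V k → Set
  Walk zero x z = x ≡ z
  Walk (suc t) x z = Σ (Fin k) λ a → Walk t (x · a) z

  walk-depth : ∀ t x z → Walk t x z → ∣ z ∣ᵥ ≤ t + ∣ x ∣ᵥ
  walk-depth zero x .x refl = ≤-refl
  walk-depth (suc t) x z (a , walk) = begin
    ∣ z ∣ᵥ           ≤⟨ walk-depth t (x · a) z walk ⟩
    t + ∣ x · a ∣ᵥ   ≤⟨ +-monoʳ-≤ t (∣·∣≤ x a) ⟩
    t + suc ∣ x ∣ᵥ   ≡⟨ +-suc t ∣ x ∣ᵥ ⟩
    suc t + ∣ x ∣ᵥ   ∎
    where open ≤-Reasoning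

  walk-beneath : ∀ t x z → Walk t x z → t + ∣ x ∣ᵥ ≤ ∣ z ∣ᵥ → Beneath t x z
  walk-beneath zero x .x refl _ = beneath [] refl refl
  walk-beneath (suc t) x z (a , walk) far with ·-cases x a
  ... | inj₁ x·a≡ = beneath-· a x·a≡ (walk-beneath t (x · a) z walk (begin
    t + ∣ x · a ∣ᵥ     ≡⟨ cong (λ w → t + length w) x·a≡ ⟩
    t + suc ∣ x ∣ᵥ     ≡⟨ +-suc t ∣ x ∣ᵥ ⟩
    suc t + ∣ x ∣ᵥ     ≤⟨ far ⟩
    ∣ z ∣ᵥ             ∎))
    where open ≤-Reasoning
  ... | inj₂ x·a< = contradiction far (<⇒≱ (begin-strict
    ∣ z ∣ᵥ             ≤⟨ walk-depth t (x · a) z walk ⟩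
    t + ∣ x · a ∣ᵥ     <⟨ +-monoʳ-< t (n<1+n _) ⟩
    t + suc ∣ x · a ∣ᵥ ≡⟨ cong (t +_) x·a< ⟩
    t + ∣ x ∣ᵥ         <⟨ n<1+n _ ⟩
    suc t + ∣ x ∣ᵥ     ∎))
    where open ≤-Reasoning

  walk-to-beneath : ∀ t y y′ z → Walk t y z → Beneath t y′ z → ∣ y ∣ᵥ ≤ ∣ y′ ∣ᵥ → y ≡ y′
  walk-to-beneath t y y′ z walk y′▹z ∣y∣≤∣y′∣ = begin
    y         ≡⟨ beneath-drop (walk-beneath t y z walk far) ⟨
    dropᵥ t z ≡⟨ beneath-drop y′▹z ⟩
    y′        ∎
    where
    open ≡-Reasoning
    far : t + ∣ y ∣ᵥ ≤ ∣ z ∣ᵥ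
    far = ≤-trans (+-monoʳ-≤ t ∣y∣≤∣y′∣) (≤-reflexive (sym (beneath-depth y′▹z)))

  walkSum : ℕ → (V k → ℕ) → V k → ℕ
  walkSum zero h x = h x
  walkSum (suc t) h x = sum (map (λ a → walkSum t h (x · a)) (allFin k))

  walkSum-local : ∀ t x {h h′ : V k → ℕ} → (∀ z → Walk t x z → h z ≡ h′ z) → walkSum t h x ≡ walkSum t h′ x
  walkSum-local zero x h≡h′ = h≡h′ x refl
  walkSum-local (suc t) x h≡h′ = cong sum (map-cong (λ a → walkSum-local t (x · a) λ z walk → h≡h′ z (a , walk)) (allFin k))

  walkSum-vanishing : ∀ t x {h : V k → ℕ} → (∀ z → Walk t x z → h z ≡ 0) → walkSum t h x ≡ 0
  walkSum-vanishing zero x h≡0 = h≡0 x refl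
  walkSum-vanishing (suc t) x h≡0 = sum-map-zero (allFin k) λ a → walkSum-vanishing t (x · a) λ z walk → h≡0 z (a , walk)

  walkSum-+ : ∀ t x (f g : V k → ℕ) → walkSum t (λ y → f y + g y) x ≡ walkSum t f x + walkSum t g x
  walkSum-+ zero x f g = refl
  walkSum-+ (suc t) x f g =
    trans (cong sum (map-cong (λ a → walkSum-+ t (x · a) f g) (allFin k))) (sum-map-+ (allFin k) _ _)

  walkSum-* : ∀ t x c (f : V k → ℕ) → walkSum t (λ y → c * f y) x ≡ c * walkSum t f x
  walkSum-* zero x c f = refl
  walkSum-* (suc t) x c f =
    trans (cong sum (map-cong (λ a → walkSum-* t (x · a) c f) (allFin k))) (sum-map-* (allFin k) c _)

module Descent {k : ℕ} (a₀ a₁ : Fin k) (a₀≢a₁ : a₀ ≢ a₁) where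

  away : V k → Fin k
  away ([] , _) = a₀
  away ((b ∷ _) , _) = if does (b ≟ a₀) then a₁ else a₀

  away-extends : ∀ x → proj₁ (x · away x) ≡ away x ∷ proj₁ x
  away-extends x = ·-extends x (away x) (away-≢ x)
    where
    away-≢ : ∀ x b w → proj₁ x ≡ b ∷ w → away x ≢ b
    away-≢ ((b ∷ w) , _) .b .w refl with b ≟ a₀
    ... | yes b≡a₀ = λ a₁≡b → a₀≢a₁ (trans (sym b≡a₀) (sym a₁≡b))
    ... | no b≢a₀ = λ a₀≡b → b≢a₀ (sym a₀≡b)

  descend : ℕ → V k → V k
  descend zero x = x
  descend (suc t) x = descend t (x · away x)

  descend-beneath : ∀ t x → Beneath t x (descend t x)
  descend-beneath zero x = beneath [] refl refl
  descend-beneath (suc t) x = beneath-· (away x) (away-extends x) (descend-beneath t (x · away x))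

  descend-depth : ∀ t x → ∣ descend t x ∣ᵥ ≡ t + ∣ x ∣ᵥ
  descend-depth t x = beneath-depth (descend-beneath t x)

  point : V k → ℕ → V k → ℕ
  point e c z = if does (z ≟ᵥ e) then c else 0

  walkSum-point-descend : ∀ t x c → walkSum t (point (descend t x) c) x ≡ c
  walkSum-point-descend zero x c = if-yes (x ≟ᵥ x) refl
  walkSum-point-descend (suc t) x c =
    trans (sum-allFin-single k _ (away x) off-path) (walkSum-point-descend t (x · away x) c)
    where
    e : V k
    e = descend t (x · away x)
    off-path : ∀ a → a ≢ away x → walkSum t (point e c) (x · a) ≡ 0
    off-path a a≢away = walkSum-vanishing t (x · a) λ z walk →
      if-no (z ≟ᵥ e) λ { refl → a≢away (·-injective-extending x a (away x) (away-extends x)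
        (walk-to-beneath t (x · a) (x · away x) z walk (descend-beneath t (x · away x))
          (≤-trans (∣·∣≤ x a) (≤-reflexive (sym (cong length (away-extends x))))))) }

  plant : ℕ → (V k → ℕ) → V k → ℕ
  plant t m y = if does (y ≟ᵥ descend t (dropᵥ t y)) then m (dropᵥ t y) else 0

  plant-descend : ∀ t m x → plant t m (descend t x) ≡ m x
  plant-descend t m x rewrite beneath-drop (descend-beneath t x) = if-yes (descend t x ≟ᵥ descend t x) refl

  plant-≡0 : ∀ t m y → (y ≡ descend t (dropᵥ t y) → m (dropᵥ t y) ≡ 0) → plant t m y ≡ 0
  plant-≡0 t m y m≡0 with y ≟ᵥ descend t (dropᵥ t y)
  ... | yes y≡ = m≡0 y≡
  ... | no _ = refl

  plant-shallow : ∀ t m y → ∣ y ∣ᵥ < t → plant t m y ≡ 0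
  plant-shallow t m y ∣y∣<t = plant-≡0 t m y λ y≡ →
    contradiction (trans (cong ∣_∣ᵥ y≡) (descend-depth t (dropᵥ t y))) (<⇒≢ (<-≤-trans ∣y∣<t (m≤m+n t _)))

  plant-+ : ∀ t (m m₁ m₂ : V k → ℕ) → (∀ z → m z ≡ m₁ z + m₂ z) → ∀ y → plant t m y ≡ plant t m₁ y + plant t m₂ y
  plant-+ t m m₁ m₂ m≡ y with y ≟ᵥ descend t (dropᵥ t y)
  ... | yes _ = m≡ (dropᵥ t y)
  ... | no _ = refl

  -- values planted for vertices at least as deep as x reach x in t steps only from descend t x
  walkSum-plant : ∀ t x m → (∀ z → ∣ z ∣ᵥ < ∣ x ∣ᵥ → m z ≡ 0) → walkSum t (plant t m) x ≡ m x
  walkSum-plant t x m shallow≡0 =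
    trans (walkSum-local t x plant≡point) (walkSum-point-descend t x (m x))
    where
    plant≡point : ∀ z → Walk t x z → plant t m z ≡ point (descend t x) (m x) z
    plant≡point z walk with z ≟ᵥ descend t x
    ... | yes refl = plant-descend t m x
    ... | no z≢ = plant-≡0 t m z λ z≡ → case ∣ dropᵥ t z ∣ᵥ <? ∣ x ∣ᵥ of λ where
      (yes shallow) → shallow≡0 _ shallow
      (no deep) → contradiction (trans z≡ (cong (descend t) (sym (walk-to-beneath t x (dropᵥ t z) z walk
                    (subst (Beneath t (dropᵥ t z)) (sym z≡) (descend-beneath t _)) (≮⇒≥ deep))))) z≢

module RotorRouter (k : ℕ) {{_ : NonZero k}} (σ : RotorSeqs k) where
  open RotorArithmetic k

  record Surplus (D : V k → ℕ) (c c′ : Config k) : Set where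
    constructor surplus
    field
      rotor≡ : ∀ x → rotor c x ≡ rotor c′ x
      chips≡ : ∀ x → chips c x ≡ chips c′ x + D x

  surplus-cong : ∀ {D D′ c c′} → (∀ x → D x ≡ D′ x) → Surplus D c c′ → Surplus D′ c c′
  surplus-cong D≡D′ (surplus rotor≡ chips≡) = surplus rotor≡ λ x → trans (chips≡ x) (cong (_ +_) (D≡D′ x))

  -- k extra chips at a vertex send one chip to each neighbour and leave its rotor in place
  step-surplus : ∀ (D : V k → ℕ) c c′ → Surplus (λ x → k * D x) c c′ →
                 Surplus (λ y → sum (map (λ a → D (y · a)) (allFin k))) (step k σ c) (step k σ c′)
  step-surplus D c c′ (surplus rotor≡ chips≡) = surplus advance≡ sent≡
    where
    advance≡ : ∀ x → advance k (rotor c x) (chips c x) ≡ advance k (rotor c′ x) (chips c′ x)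
    advance≡ x = trans (cong₂ (advance k) (rotor≡ x) (chips≡ x)) (advance-+-multiple (rotor c′ x) (chips c′ x) (D x))
    sentFrom : Config k → V k → Fin k → ℕ
    sentFrom c x a = sent k (rotor c x) (chips c x) (σ x ⟨$⟩ˡ a)
    sent≡ : ∀ y → sum (map (λ a → sentFrom c (y · a) a) (allFin k))
                ≡ sum (map (λ a → sentFrom c′ (y · a) a) (allFin k)) + sum (map (λ a → D (y · a)) (allFin k))
    sent≡ y = trans (cong sum (map-cong (λ a → trans (cong₂ (λ r n → sent k r n (σ (y · a) ⟨$⟩ˡ a)) (rotor≡ (y · a)) (chips≡ (y · a)))
                                                      (sent-+-multiple (rotor c′ (y · a)) (chips c′ (y · a)) (D (y · a)) _))
                                        (allFin k)))
                    (sum-map-+ (allFin k) _ _)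

  run-surplus : ∀ arr0 n (f g h : V k → ℕ) → (∀ y → f y ≡ g y + k ^ n * h y) → ∀ s → s ≤ n →
                Surplus (λ x → k ^ (n ∸ s) * walkSum s h x) (run k σ arr0 f s) (run k σ arr0 g s)
  run-surplus arr0 n f g h f≡ zero _ = surplus (λ x → refl) f≡
  run-surplus arr0 n f g h f≡ (suc s) s<n =
    surplus-cong (λ y → sum-map-* (allFin k) (k ^ (n ∸ suc s)) (λ a → walkSum s h (y · a)))
      (step-surplus D _ _ (surplus-cong regroup (run-surplus arr0 n f g h f≡ s (<⇒≤ s<n))))
    where
    D : V k → ℕ
    D x = k ^ (n ∸ suc s) * walkSum s h x
    regroup : ∀ x → k ^ (n ∸ s) * walkSum s h x ≡ k * D x
    regroup x = trans (cong (λ e → k ^ e * walkSum s h x) (+-∸-assoc 1 s<n)) (*-assoc k _ _)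

  run-+-power : ∀ arr0 t (f g h : V k → ℕ) → (∀ y → f y ≡ g y + k ^ t * h y) →
                ∀ x → chips (run k σ arr0 f t) x ≡ chips (run k σ arr0 g t) x + walkSum t h x
  run-+-power arr0 t f g h f≡ x = begin
    chips (run k σ arr0 f t) x                                ≡⟨ Surplus.chips≡ (run-surplus arr0 t f g h f≡ t ≤-refl) x ⟩
    chips (run k σ arr0 g t) x + k ^ (t ∸ t) * walkSum t h x  ≡⟨ cong (λ e → chips (run k σ arr0 g t) x + k ^ e * walkSum t h x) (n∸n≡0 t) ⟩
    chips (run k σ arr0 g t) x + 1 * walkSum t h x            ≡⟨ cong (chips (run k σ arr0 g t) x +_) (*-identityˡ _) ⟩
    chips (run k σ arr0 g t) x + walkSum t h x                ∎
    where open ≡-Reasoning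

  run-even : ∀ arr0 f → IsEven f → ∀ t y → (∣ y ∣ᵥ + t) % 2 ≡ 1 → chips (run k σ arr0 f t) y ≡ 0
  run-even arr0 f even zero y odd = even y (trans (cong (_% 2) (sym (+-identityʳ ∣ y ∣ᵥ))) odd)
  run-even arr0 f even (suc t) y odd = sum-map-zero (allFin k) λ a →
    cong (λ n → sent k (rotor (run k σ arr0 f t) (y · a)) n (σ (y · a) ⟨$⟩ˡ a)) (run-even arr0 f even t (y · a) (trans (·-parity y a t) odd))

module Construction (k : ℕ) {{_ : NonZero k}} (σ : RotorSeqs k) (arr0 : V k → Fin k)
                    (π : V k → ℕ → Fin k) (a₀ a₁ : Fin k) (a₀≢a₁ : a₀ ≢ a₁) where
  open RotorRouter k σ
  open Descent a₀ a₁ a₀≢a₁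

  chipsOf : (V k → ℕ) → V k → ℕ → ℕ
  chipsOf f x t = chipsAt k σ arr0 f x t

  correction : ℕ → (V k → ℕ) → V k → ℕ
  correction t f x = if does (∣ x ∣ᵥ % 2 ≟ℕ t % 2) then toℕ (π x t) + (k ∸ chipsOf f x t % k) else 0

  digitsBelow : ℕ → (V k → ℕ) → ℕ → V k → ℕ
  withDigitsBelow : ℕ → (V k → ℕ) → ℕ → V k → ℕ

  digitsBelow t f zero y = 0
  digitsBelow t f (suc d) y =
    digitsBelow t f d y + (if does (∣ y ∣ᵥ ≟ℕ d) then correction t (withDigitsBelow t f d) y else 0)

  withDigitsBelow t f d z = f z + k ^ t * plant t (digitsBelow t f d) z

  digits : ℕ → (V k → ℕ) → V k → ℕ
  digits t f y = digitsBelow t f (suc ∣ y ∣ᵥ) y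

  digitsFrom : ℕ → (V k → ℕ) → ℕ → V k → ℕ
  digitsFrom t f d y = if does (d ≤? ∣ y ∣ᵥ) then digits t f y else 0

  stage : ℕ → V k → ℕ
  stage zero y = 0
  stage (suc t) y = stage t y + k ^ t * plant t (digits t (stage t)) y

  -- stages after suc ∣ y ∣ᵥ plant nothing at y (stage-stable)
  f0 : V k → ℕ
  f0 y = stage (suc ∣ y ∣ᵥ) y

  digitsBelow-deep : ∀ t f d y → d ≤ ∣ y ∣ᵥ → digitsBelow t f d y ≡ 0
  digitsBelow-deep t f zero y _ = refl
  digitsBelow-deep t f (suc d) y d<∣y∣ =
    cong₂ _+_ (digitsBelow-deep t f d y (<⇒≤ d<∣y∣)) (if-no (∣ y ∣ᵥ ≟ℕ d) (>⇒≢ d<∣y∣))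

  digitsBelow-shallow : ∀ t f d y → ∣ y ∣ᵥ < d → digitsBelow t f d y ≡ digits t f y
  digitsBelow-shallow t f (suc d) y (s≤s ∣y∣≤d) with m≤n⇒m<n∨m≡n ∣y∣≤d
  ... | inj₁ ∣y∣<d = trans (cong₂ _+_ (digitsBelow-shallow t f d y ∣y∣<d) (if-no (∣ y ∣ᵥ ≟ℕ d) (<⇒≢ ∣y∣<d))) (+-identityʳ _)
  ... | inj₂ ∣y∣≡d = cong (λ n → digitsBelow t f (suc n) y) (sym ∣y∣≡d)

  digits-correction : ∀ t f y → digits t f y ≡ correction t (withDigitsBelow t f ∣ y ∣ᵥ) y
  digits-correction t f y = cong₂ _+_ (digitsBelow-deep t f ∣ y ∣ᵥ y ≤-refl) (if-yes (∣ y ∣ᵥ ≟ℕ ∣ y ∣ᵥ) refl)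

  digits-split : ∀ t f d y → digits t f y ≡ digitsBelow t f d y + digitsFrom t f d y
  digits-split t f d y with ∣ y ∣ᵥ <? d
  ... | yes shallow = sym (trans (cong₂ _+_ (digitsBelow-shallow t f d y shallow) (if-no (d ≤? ∣ y ∣ᵥ) (<⇒≱ shallow))) (+-identityʳ _))
  ... | no deep = sym (cong₂ _+_ (digitsBelow-deep t f d y (≮⇒≥ deep)) (if-yes (d ≤? ∣ y ∣ᵥ) (≮⇒≥ deep)))

  digits-parity : ∀ t f y → ∣ y ∣ᵥ % 2 ≢ t % 2 → digits t f y ≡ 0
  digits-parity t f y differ = trans (digits-correction t f y) (if-no (∣ y ∣ᵥ % 2 ≟ℕ t % 2) differ)

  stage-even : ∀ t → IsEven (stage t)
  stage-even zero y _ = refl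
  stage-even (suc t) y odd = trans (cong₂ (λ a b → a + k ^ t * b) (stage-even t y odd) planted≡0) (*-zeroʳ (k ^ t))
    where
    planted≡0 : plant t (digits t (stage t)) y ≡ 0
    planted≡0 = plant-≡0 t (digits t (stage t)) y λ y≡ → digits-parity t (stage t) (dropᵥ t y) λ same →
      0≢1+n (begin
        0                            ≡⟨ m%2≡n%2⇒[m+n]%2≡0 t _ (sym same) ⟨
        (t + ∣ dropᵥ t y ∣ᵥ) % 2      ≡⟨ cong (_% 2) (trans (cong ∣_∣ᵥ y≡) (descend-depth t _)) ⟨
        ∣ y ∣ᵥ % 2                    ≡⟨ odd ⟩
        1                            ∎)
      where open ≡-Reasoning

  stage-stable : ∀ y j → stage (suc ∣ y ∣ᵥ + j) y ≡ f0 y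
  stage-stable y zero = cong (λ n → stage n y) (+-identityʳ (suc ∣ y ∣ᵥ))
  stage-stable y (suc j) = begin
    stage (suc ∣ y ∣ᵥ + suc j) y                          ≡⟨ cong (λ n → stage n y) (+-suc (suc ∣ y ∣ᵥ) j) ⟩
    stage n y + k ^ n * plant n (digits n (stage n)) y    ≡⟨ cong₂ (λ a b → a + k ^ n * b) (stage-stable y j) (plant-shallow n (digits n (stage n)) y (s≤s (m≤m+n _ j))) ⟩
    f0 y + k ^ n * 0                                      ≡⟨ cong (f0 y +_) (*-zeroʳ (k ^ n)) ⟩
    f0 y + 0                                              ≡⟨ +-identityʳ (f0 y) ⟩
    f0 y                                                  ∎
    where
    open ≡-Reasoning
    n : ℕ
    n = suc ∣ y ∣ᵥ + j

  stage-extends : ∀ t n y → Σ ℕ λ c → stage (t + n) y ≡ stage t y + k ^ t * c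
  stage-extends t zero y = 0 , (begin
    stage (t + 0) y        ≡⟨ cong (λ m → stage m y) (+-identityʳ t) ⟩
    stage t y              ≡⟨ +-identityʳ (stage t y) ⟨
    stage t y + 0          ≡⟨ cong (stage t y +_) (*-zeroʳ (k ^ t)) ⟨
    stage t y + k ^ t * 0  ∎)
    where open ≡-Reasoning
  stage-extends t (suc n) y with stage-extends t n y
  ... | c , stage≡ = c + k ^ n * p , (begin
    stage (t + suc n) y                         ≡⟨ cong (λ m → stage m y) (+-suc t n) ⟩
    stage (t + n) y + k ^ (t + n) * p           ≡⟨ cong₂ (λ a b → a + b * p) stage≡ (^-distribˡ-+-* k t n) ⟩
    stage t y + k ^ t * c + k ^ t * k ^ n * p   ≡⟨ regroup (stage t y) (k ^ t) c (k ^ n) p ⟩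
    stage t y + k ^ t * (c + k ^ n * p)         ∎)
    where
    open ≡-Reasoning
    p : ℕ
    p = plant (t + n) (digits (t + n) (stage (t + n))) y
    regroup : ∀ a q c r p → a + q * c + q * r * p ≡ a + q * (c + r * p)
    regroup = solve 5 (λ a q c r p → a :+ q :* c :+ q :* r :* p := a :+ q :* (c :+ r :* p)) refl

  f0-extends : ∀ t → Σ (V k → ℕ) λ R → ∀ y → f0 y ≡ stage t y + k ^ t * R y
  f0-extends t = (λ y → proj₁ (extension y)) , λ y → begin
    f0 y                               ≡⟨ stage-stable y t ⟨
    stage (suc ∣ y ∣ᵥ + t) y           ≡⟨ cong (λ n → stage n y) (+-comm (suc ∣ y ∣ᵥ) t) ⟩
    stage (t + suc ∣ y ∣ᵥ) y           ≡⟨ proj₂ (extension y) ⟩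
    stage t y + k ^ t * proj₁ (extension y) ∎
    where
    open ≡-Reasoning
    extension : ∀ y → Σ ℕ λ c → stage (t + suc ∣ y ∣ᵥ) y ≡ stage t y + k ^ t * c
    extension y = stage-extends t (suc ∣ y ∣ᵥ) y

  f0-even : IsEven f0
  f0-even y = stage-even (suc ∣ y ∣ᵥ) y

  f0-split : ∀ t d → Σ (V k → ℕ) λ R → ∀ y →
             f0 y ≡ withDigitsBelow t (stage t) d y + k ^ t * (plant t (digitsFrom t (stage t) d) y + k * R y)
  f0-split t d = R , λ y → begin
    f0 y
      ≡⟨ proj₂ (f0-extends (suc t)) y ⟩
    stage t y + k ^ t * plant t m y + k * k ^ t * R y
      ≡⟨ cong (λ n → stage t y + k ^ t * n + k * k ^ t * R y) (plant-+ t m below from (digits-split t (stage t) d) y) ⟩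
    stage t y + k ^ t * (plant t below y + plant t from y) + k * k ^ t * R y
      ≡⟨ regroup (stage t y) (k ^ t) (plant t below y) (plant t from y) k (R y) ⟩
    stage t y + k ^ t * plant t below y + k ^ t * (plant t from y + k * R y)
      ∎
    where
    open ≡-Reasoning
    R m below from : V k → ℕ
    R = proj₁ (f0-extends (suc t))
    m = digits t (stage t)
    below = digitsBelow t (stage t) d
    from = digitsFrom t (stage t) d
    regroup : ∀ s q a b k r → s + q * (a + b) + k * q * r ≡ s + q * a + q * (b + k * r)
    regroup = solve 6 (λ s q a b k r → s :+ q :* (a :+ b) :+ k :* q :* r := s :+ q :* a :+ q :* (b :+ k :* r)) refl

  walkSum-digitsFrom : ∀ t f x → walkSum t (plant t (digitsFrom t f ∣ x ∣ᵥ)) x ≡ correction t (withDigitsBelow t f ∣ x ∣ᵥ) x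
  walkSum-digitsFrom t f x = begin
    walkSum t (plant t (digitsFrom t f ∣ x ∣ᵥ)) x  ≡⟨ walkSum-plant t x _ (λ z shallow → if-no (∣ x ∣ᵥ ≤? ∣ z ∣ᵥ) (<⇒≱ shallow)) ⟩
    digitsFrom t f ∣ x ∣ᵥ x                        ≡⟨ if-yes (∣ x ∣ᵥ ≤? ∣ x ∣ᵥ) ≤-refl ⟩
    digits t f x                                   ≡⟨ digits-correction t f x ⟩
    correction t (withDigitsBelow t f ∣ x ∣ᵥ) x    ∎
    where open ≡-Reasoning

  f0-residue-same-parity : ∀ x t → ∣ x ∣ᵥ % 2 ≡ t % 2 → chipsOf f0 x t % k ≡ toℕ (π x t)
  f0-residue-same-parity x t same = begin
    chipsOf f0 x t % k
      ≡⟨ cong (_% k) (run-+-power arr0 t f0 B H (proj₂ (f0-split t ∣ x ∣ᵥ)) x) ⟩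
    (chipsOf B x t + walkSum t H x) % k
      ≡⟨ cong (λ n → (chipsOf B x t + n) % k) (walkSum-+ t x _ _) ⟩
    (chipsOf B x t + (walkSum t (plant t (digitsFrom t (stage t) ∣ x ∣ᵥ)) x + walkSum t (λ y → k * R y) x)) % k
      ≡⟨ cong₂ (λ n n′ → (chipsOf B x t + (n + n′)) % k) (walkSum-digitsFrom t (stage t) x) (walkSum-* t x k R) ⟩
    (chipsOf B x t + (correction t B x + k * walkSum t R x)) % k
      ≡⟨ cong (λ n → (chipsOf B x t + (n + k * walkSum t R x)) % k) (if-yes (∣ x ∣ᵥ % 2 ≟ℕ t % 2) same) ⟩
    (chipsOf B x t + (toℕ (π x t) + (k ∸ chipsOf B x t % k) + k * walkSum t R x)) % k
      ≡⟨ %-complement k (chipsOf B x t) (toℕ (π x t)) (walkSum t R x) (toℕ<n (π x t)) ⟩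
    toℕ (π x t)
      ∎
    where
    open ≡-Reasoning
    R B H : V k → ℕ
    R = proj₁ (f0-split t ∣ x ∣ᵥ)
    B = withDigitsBelow t (stage t) ∣ x ∣ᵥ
    H y = plant t (digitsFrom t (stage t) ∣ x ∣ᵥ) y + k * R y

  f0-residue : (∀ x t → ∣ x ∣ᵥ % 2 ≢ t % 2 → toℕ (π x t) ≡ 0) → ∀ x t → chipsOf f0 x t % k ≡ toℕ (π x t)
  f0-residue π-even x t with ∣ x ∣ᵥ % 2 ≟ℕ t % 2
  ... | yes same = f0-residue-same-parity x t same
  ... | no differ = begin
    chipsOf f0 x t % k ≡⟨ cong (_% k) (run-even arr0 f0 f0-even t x (m%2≢n%2⇒[m+n]%2≡1 ∣ x ∣ᵥ t differ)) ⟩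
    0 % k              ≡⟨ m<n⇒m%n≡m (>-nonZero⁻¹ k) ⟩
    0                  ≡⟨ π-even x t differ ⟨
    toℕ (π x t)        ∎
    where open ≡-Reasoning

theorem1 : (k : ℕ) {{_ : NonZero k}} → 3 ≤ k →
    (σ : RotorSeqs k) (arr0 : V k → Fin k) →
    (π : V k → ℕ → Fin k) →
    (∀ x t → ∣ x ∣ᵥ % 2 ≢ t % 2 → toℕ (π x t) ≡ 0) →
    Σ (V k → ℕ) (λ f0 → IsEven f0 ×
      (∀ x t → chipsAt k σ arr0 f0 x t mod k ≡ π x t))
theorem1 k@(suc (suc _)) (s≤s (s≤s _)) σ arr0 π π-even =
  f0 , f0-even , λ x t → toℕ-injective (trans (toℕ-fromℕ< _) (f0-residue π-even x t))
  where open Construction k σ arr0 π Fin.zero (Fin.suc Fin.zero) (λ ())
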